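{- For each integer $k\ge 1$, the maximum possible degree of a vertex in a graph $G$ with $\mathrm{adim}(G)=k$ is $k+2^k-1$.
   Context: All graphs are finite, simple and undirected. For vertices $x,y$ of a graph $G$, $d(x,y)$ is the length of a shortest $x$–$y$ path ($\infty$ if in different components), and $d_1(x,y)=\min\{d(x,y),2\}$. A set $S\subseteq V(G)$ is an adjacency resolving set of $G$ if for any two distinct $x,y\in V(G)$ there is $z\in S$ with $d_1(x,z)\neq d_1(y,z)$; the adjacency dimension $\mathrm{adim}(G)$ is the minimum cardinality of an adjacency resolving set. -}

module Defs where

open import Data.Nat using (ℕ; _≤_)
open import Data.Bool using (Bool; true; false; if_then_else_)
open import Data.Fin using (Fin; _≟_)
open import Data.Fin.Subset using (Subset; _∈_; ∣_∣)
open import Data.Vec using (tabulate)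
open import Data.Product using (Σ; _×_; ∃)
open import Relation.Nullary using (¬_; does)
open import Relation.Binary.PropositionalEquality using (_≡_; _≢_)

record Graph : Set where
  field
    n     : ℕ
    adj   : Fin n → Fin n → Bool
    sym   : ∀ x y → adj x y ≡ adj y x
    irrefl : ∀ x → adj x x ≡ false

open Graph public

-- d₁(x,y) = min{d(x,y),2}: 0 if x = y, 1 if x ~ y, 2 otherwise
-- (distance ≥ 2 or ∞).
d₁ : (G : Graph) → Fin (n G) → Fin (n G) → ℕ
d₁ G x y = if does (x ≟ y) then 0 else (if adj G x y then 1 else 2)

neighbourhood : (G : Graph) → Fin (n G) → Subset (n G)
neighbourhood G x = tabulate (adj G x)

degree : (G : Graph) → Fin (n G) → ℕ
degree G x = ∣ neighbourhood G x ∣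

IsAdjResolving : (G : Graph) → Subset (n G) → Set
IsAdjResolving G S =
  ∀ (x y : Fin (n G)) → x ≢ y →
    Σ (Fin (n G)) (λ z → z ∈ S × d₁ G x z ≢ d₁ G y z)

AdimIs : Graph → ℕ → Set
AdimIs G k =
  Σ (Subset (n G)) (λ S → IsAdjResolving G S × ∣ S ∣ ≡ k)
  × (∀ (S : Subset (n G)) → IsAdjResolving G S → k ≤ ∣ S ∣)

module Submission where

-- If S is an adjacency resolving set, two vertices outside S
-- can only be told apart by a vertex of S that is adjacent to exactly one of
-- them, so the map sending a vertex outside S to its neighbourhood within S
-- is injective.  Hence at most 2^|S| vertices lie outside S and
-- |V(G)| ≤ |S| + 2^|S|.  Since a vertex has at most |V(G)| - 1 neighbours, every degree
-- in a graph with adim(G) = k is at most k + 2^k - 1.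
--
-- Take an independent set A = {a₁,…,a_k} together with a clique
-- B whose 2^k vertices are indexed by the bit strings of length k, the vertex
-- with code c being adjacent to a_i iff the i-th bit of c is set.  A resolves
-- the graph, the lower bound |V| ≤ |S| + 2^|S| together with strict
-- monotonicity of s ↦ s + 2^s forces every resolving set to have at least k
-- elements, and the vertex with the all-ones code is adjacent to all other
-- k + 2^k - 1 vertices.

open import Defs hiding (sym)
open import Data.Nat using (ℕ; zero; suc; _≤_; _<_; _+_; _∸_; _^_; z≤n; s≤s)
open import Data.Nat.Properties
  using (≤-refl; ≤-trans; +-suc; ≤-reflexive; ≤-antisym; _≤?_; ≰⇒>; <⇒≱; +-mono-≤; +-mono-<;
         +-monoʳ-≤; +-identityʳ; ^-monoʳ-<; m+n≤o⇒m≤o∸n; m+n∸n≡m; ∸-monoˡ-≤; module ≤-Reasoning)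
open import Data.Bool using (Bool; true; false; not; _∧_; if_then_else_)
open import Data.Bool.Properties using (not-injective; ∧-conicalˡ; ∧-conicalʳ) renaming (_≟_ to _≟ᵇ_)
open import Data.Fin using (Fin; zero; suc; _≟_; splitAt; _↑ˡ_; _↑ʳ_; remQuot; combine)
open import Data.Fin.Properties
  using (suc-injective; splitAt-↑ˡ; splitAt-↑ʳ; splitAt⁻¹-↑ˡ; splitAt⁻¹-↑ʳ;
         remQuot-combine; combine-remQuot; ¬∀⟶∃¬)
open import Data.Fin.Subset using (Subset; _∈_; ∣_∣; ⊤; ⊥; inside; outside)
open import Data.Fin.Subset.Properties using (∣⊤∣≡n; ∣⊥∣≡0)
open import Data.Vec using (_∷_; []; _++_; tabulate; lookup)
open import Data.Vec.Properties
  using (tabulate∘lookup; []=⇒lookup; lookup⇒[]=; lookup-++ˡ; lookup-replicate)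
open import Data.Product using (Σ; _×_; _,_; proj₁; proj₂; ∃-syntax)
open import Data.Sum using (_⊎_; inj₁; inj₂)
open import Function using (_∘_)
open import Relation.Nullary using (does; yes; no; contradiction)
open import Relation.Binary.PropositionalEquality
  using (_≡_; _≢_; refl; sym; trans; cong; cong₂; subst; module ≡-Reasoning)

count : ∀ {m} → (Fin m → Bool) → ℕ
count {zero}  p = 0
count {suc m} p = (if p zero then 1 else 0) + count (p ∘ suc)

count-tabulate : ∀ {m} (p : Fin m → Bool) → ∣ tabulate p ∣ ≡ count p
count-tabulate {zero}  p = refl
count-tabulate {suc m} p with p zero
... | true  = cong suc (count-tabulate (p ∘ suc))
... | false = count-tabulate (p ∘ suc)

count-lookup : ∀ {m} (S : Subset m) → ∣ S ∣ ≡ count (lookup S)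
count-lookup S = trans (cong ∣_∣ (sym (tabulate∘lookup S))) (count-tabulate (lookup S))

count-complement : ∀ {m} (p : Fin m → Bool) → count p + count (not ∘ p) ≡ m
count-complement {zero}  p = refl
count-complement {suc m} p with p zero | count-complement (p ∘ suc)
... | true  | e = cong suc e
... | false | e = trans (+-suc _ _) (cong suc e)

count-split : ∀ {m} (p q : Fin m → Bool) →
              count p ≡ count (λ x → p x ∧ q x) + count (λ x → p x ∧ not (q x))
count-split {zero}  p q = refl
count-split {suc m} p q with p zero | q zero | count-split (p ∘ suc) (q ∘ suc)
... | true  | true  | e = cong suc e
... | true  | false | e = trans (cong suc e) (sym (+-suc _ _))
... | false | _     | e = e

count-positive : ∀ {m} (p : Fin m → Bool) (v : Fin m) → p v ≡ true → 1 ≤ count p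
count-positive p zero    pv rewrite pv = s≤s z≤n
count-positive p (suc v) pv = ≤-trans (count-positive (p ∘ suc) v pv) (+-mono-≤ {0} z≤n ≤-refl)

count-none : ∀ {m} (p : Fin m → Bool) → (∀ x → p x ≢ true) → count p ≡ 0
count-none {zero}  p none = refl
count-none {suc m} p none with p zero in e
... | true  = contradiction e (none zero)
... | false = count-none (p ∘ suc) (none ∘ suc)

count-subsingleton : ∀ {m} (p : Fin m → Bool) →
                     (∀ x y → p x ≡ true → p y ≡ true → x ≡ y) → count p ≤ 1
count-subsingleton {zero}  p unique = z≤n
count-subsingleton {suc m} p unique with p zero in e
... | true  = ≤-reflexive (cong suc (count-none (p ∘ suc) (λ x px → zero≢suc (unique zero (suc x) e px))))
  where
  zero≢suc : ∀ {x : Fin m} → Fin.zero ≢ suc x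
  zero≢suc ()
... | false = count-subsingleton (p ∘ suc) (λ x y px py → suc-injective (unique (suc x) (suc y) px py))

Separates : ∀ {m N} → (Fin m → Fin N → Bool) → (Fin N → Bool) → (Fin m → Bool) → Set
Separates f S T = ∀ x y → T x ≡ true → T y ≡ true → x ≢ y →
                  ∃[ z ] S z ≡ true × f x z ≢ f y z

separates-sub : ∀ {m N} (f : Fin m → Fin N → Bool) S (T T′ : Fin m → Bool) →
                (∀ x → T′ x ≡ true → T x ≡ true) → Separates f S T → Separates f S T′
separates-sub f S T T′ T′⊆T sep x y tx ty = sep x y (T′⊆T x tx) (T′⊆T y ty)

separates-tail : ∀ {m N} (f : Fin m → Fin (suc N) → Bool) S T →
                 (∀ x y → T x ≡ true → T y ≡ true → S zero ≡ true → f x zero ≡ f y zero) →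
                 Separates f S T → Separates (λ x z → f x (suc z)) (S ∘ suc) T
separates-tail f S T agree sep x y tx ty x≢y with sep x y tx ty x≢y
... | zero  , s0 , differ = contradiction (agree x y tx ty s0) differ
... | suc z , sz , differ = z , sz , differ

separation-bound : ∀ {m} N (f : Fin m → Fin N → Bool) S T →
                   Separates f S T → count T ≤ 2 ^ count S
separation-bound zero f S T sep = count-subsingleton T unique
  where
  unique : ∀ x y → T x ≡ true → T y ≡ true → x ≡ y
  unique x y tx ty with x ≟ y
  ... | yes x≡y = x≡y
  ... | no  x≢y with sep x y tx ty x≢y
  ... | () , _
separation-bound {m} (suc N) f S T sep with S zero in s0
... | false = separation-bound N (λ x z → f x (suc z)) (S ∘ suc) T
               (separates-tail f S T (λ _ _ _ _ s0′ → contradiction (trans (sym s0) s0′) λ ()) sep)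
-- A selected first feature splits T into two halves, each separated by the
-- remaining features.
... | true = begin
    count T                      ≡⟨ count-split T first ⟩
    count T₁ + count T₀          ≤⟨ +-mono-≤ (half T₁ true  (λ _ → ∧-conicalˡ _ _) (λ _ → ∧-conicalʳ _ _))
                                             (half T₀ false (λ _ → ∧-conicalˡ _ _)
                                                            (λ _ → not-injective ∘ ∧-conicalʳ _ _)) ⟩
    2 ^ c + 2 ^ c                ≡⟨ cong (2 ^ c +_) (sym (+-identityʳ (2 ^ c))) ⟩
    2 ^ suc c                    ∎
  where
  open ≤-Reasoning
  first : Fin m → Bool
  first x = f x zero
  c : ℕ
  c = count (S ∘ suc)
  T₁ T₀ : Fin m → Bool
  T₁ x = T x ∧ first x
  T₀ x = T x ∧ not (first x)
  half : ∀ T′ b → (∀ x → T′ x ≡ true → T x ≡ true) → (∀ x → T′ x ≡ true → first x ≡ b) →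
         count T′ ≤ 2 ^ c
  half T′ b T′⊆T fixed = separation-bound N (λ x z → f x (suc z)) (S ∘ suc) T′
    (separates-tail f S T′ (λ x y tx ty _ → trans (fixed x tx) (sym (fixed y ty)))
      (separates-sub f S T T′ T′⊆T sep))

level : Bool → ℕ
level b = if b then 1 else 2

level-injective : ∀ {a b} → level a ≡ level b → a ≡ b
level-injective {true}  {true}  _ = refl
level-injective {false} {false} _ = refl
level-injective {true}  {false} ()
level-injective {false} {true}  ()

module _ (G : Graph) where

  d₁-self : ∀ x → d₁ G x x ≡ 0
  d₁-self x with x ≟ x
  ... | yes _   = refl
  ... | no  x≢x = contradiction refl x≢x

  d₁-apart : ∀ {x z} → x ≢ z → d₁ G x z ≡ level (adj G x z)
  d₁-apart {x} {z} x≢z with x ≟ z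
  ... | yes x≡z = contradiction x≡z x≢z
  ... | no  _   = refl

  self-resolves : ∀ {x y} → x ≢ y → d₁ G x x ≢ d₁ G y x
  self-resolves {x} {y} x≢y eq = level-nonzero (adj G y x)
    (trans (sym (d₁-apart (x≢y ∘ sym))) (trans (sym eq) (d₁-self x)))
    where
    level-nonzero : ∀ b → level b ≢ 0
    level-nonzero true  ()
    level-nonzero false ()

  adjacency-resolves : ∀ {x y z} → x ≢ z → y ≢ z → adj G x z ≢ adj G y z → d₁ G x z ≢ d₁ G y z
  adjacency-resolves x≢z y≢z differ eq =
    differ (level-injective (trans (sym (d₁-apart x≢z)) (trans eq (d₁-apart y≢z))))

  resolves-by-adjacency : ∀ {x y z} → x ≢ z → y ≢ z → d₁ G x z ≢ d₁ G y z → adj G x z ≢ adj G y z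
  resolves-by-adjacency x≢z y≢z differ eq =
    differ (trans (d₁-apart x≢z) (trans (cong level eq) (sym (d₁-apart y≢z))))

  -- The order bound: a graph with an adjacency resolving set S has at most
  -- |S| + 2^|S| vertices, since the vertices outside S are separated by
  -- their adjacencies to S.
  order-bound : (S : Subset (n G)) → IsAdjResolving G S → n G ≤ ∣ S ∣ + 2 ^ ∣ S ∣
  order-bound S resolving = begin
    n G                                  ≡⟨ sym (count-complement inS) ⟩
    count inS + count outS               ≤⟨ +-monoʳ-≤ (count inS)
                                              (separation-bound (n G) (adj G) inS outS separated) ⟩
    count inS + 2 ^ count inS            ≡⟨ cong (λ s → s + 2 ^ s) (sym (count-lookup S)) ⟩
    ∣ S ∣ + 2 ^ ∣ S ∣                    ∎
    where
    open ≤-Reasoning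
    inS outS : Fin (n G) → Bool
    inS  = lookup S
    outS = not ∘ inS
    outside-apart : ∀ {x z} → outS x ≡ true → inS z ≡ true → x ≢ z
    outside-apart x∉S z∈S refl with trans (sym (not-injective x∉S)) z∈S
    ... | ()
    separated : Separates (adj G) inS outS
    separated x y x∉S y∉S x≢y with resolving x y x≢y
    ... | z , z∈S , differ = z , []=⇒lookup z∈S ,
          resolves-by-adjacency (outside-apart x∉S ([]=⇒lookup z∈S))
                                (outside-apart y∉S ([]=⇒lookup z∈S)) differ

  degree-complement : ∀ v → degree G v + count (not ∘ adj G v) ≡ n G
  degree-complement v =
    trans (cong (_+ count (not ∘ adj G v)) (count-tabulate (adj G v))) (count-complement (adj G v))

  degree-bound : ∀ v → degree G v ≤ n G ∸ 1
  degree-bound v = m+n≤o⇒m≤o∸n (degree G v) (begin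
    degree G v + 1                          ≤⟨ +-monoʳ-≤ (degree G v)
                                                 (count-positive (not ∘ adj G v) v (cong not (irrefl G v))) ⟩
    degree G v + count (not ∘ adj G v)      ≡⟨ degree-complement v ⟩
    n G                                     ∎)
    where open ≤-Reasoning

  universal-degree : ∀ v → (∀ x → x ≢ v → adj G v x ≡ true) → degree G v ≡ n G ∸ 1
  universal-degree v universal = begin
    degree G v                                    ≡⟨ sym (m+n∸n≡m (degree G v) 1) ⟩
    degree G v + 1 ∸ 1                            ≡⟨ cong (λ c → degree G v + c ∸ 1) (sym only-v) ⟩
    degree G v + count (not ∘ adj G v) ∸ 1        ≡⟨ cong (_∸ 1) (degree-complement v) ⟩
    n G ∸ 1                                       ∎
    where
    open ≡-Reasoning
    non-neighbour-is-v : ∀ x → not (adj G v x) ≡ true → x ≡ v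
    non-neighbour-is-v x non-adj with x ≟ v
    ... | yes x≡v = x≡v
    ... | no  x≢v with trans (sym (not-injective non-adj)) (universal x x≢v)
    ... | ()
    only-v : count (not ∘ adj G v) ≡ 1
    only-v = ≤-antisym
      (count-subsingleton (not ∘ adj G v) λ x y px py →
         trans (non-neighbour-is-v x px) (sym (non-neighbour-is-v y py)))
      (count-positive (not ∘ adj G v) v (cong not (irrefl G v)))

-- Since s ↦ s + 2^s is strictly increasing, a resolving set of a graph with
-- k + 2^k vertices has at least k elements.
size-from-order : ∀ {k s} → k + 2 ^ k ≤ s + 2 ^ s → k ≤ s
size-from-order {k} {s} order with k ≤? s
... | yes k≤s = k≤s
... | no  k≰s = contradiction order (<⇒≱ (+-mono-< s<k (^-monoʳ-< 2 (s≤s (s≤s z≤n)) s<k)))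
  where
  s<k : s < k
  s<k = ≰⇒> k≰s

resolving-set-size : ∀ (G : Graph) k → n G ≡ k + 2 ^ k →
                     (S : Subset (n G)) → IsAdjResolving G S → k ≤ ∣ S ∣
resolving-set-size G k order S resolving =
  size-from-order (subst (_≤ ∣ S ∣ + 2 ^ ∣ S ∣) order (order-bound G S resolving))

-- Binary codes: Fin (2^k) enumerates the bit strings of length k.

isOne : Fin 2 → Bool
isOne zero       = false
isOne (suc zero) = true

isOne-injective : ∀ {q r} → isOne q ≡ isOne r → q ≡ r
isOne-injective {zero}     {zero}     _ = refl
isOne-injective {suc zero} {suc zero} _ = refl
isOne-injective {zero}     {suc zero} ()
isOne-injective {suc zero} {zero}     ()

bit : ∀ k → Fin (2 ^ k) → Fin k → Bool
bit (suc k) i zero    = isOne (proj₁ (remQuot {2} (2 ^ k) i))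
bit (suc k) i (suc a) = bit k (proj₂ (remQuot {2} (2 ^ k) i)) a

bits-injective : ∀ k {i j} → (∀ a → bit k i a ≡ bit k j a) → i ≡ j
bits-injective zero    {zero} {zero} _ = refl
bits-injective (suc k) {i}    {j}    same = begin
  i                                    ≡⟨ sym (combine-remQuot {2} (2 ^ k) i) ⟩
  combine (proj₁ qr-i) (proj₂ qr-i)    ≡⟨ cong₂ combine (isOne-injective (same zero))
                                                        (bits-injective k (same ∘ suc)) ⟩
  combine (proj₁ qr-j) (proj₂ qr-j)    ≡⟨ combine-remQuot {2} (2 ^ k) j ⟩
  j                                    ∎
  where
  open ≡-Reasoning
  qr-i qr-j : Fin 2 × Fin (2 ^ k)
  qr-i = remQuot (2 ^ k) i
  qr-j = remQuot (2 ^ k) j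

ones : ∀ k → Fin (2 ^ k)
ones zero    = zero
ones (suc k) = combine {2} (suc zero) (ones k)

bit-ones : ∀ k a → bit k (ones k) a ≡ true
bit-ones (suc k) zero    = cong (isOne ∘ proj₁) (remQuot-combine {2} {2 ^ k} (suc zero) (ones k))
bit-ones (suc k) (suc a) =
  trans (cong (λ qr → bit k (proj₂ qr) a) (remQuot-combine {2} {2 ^ k} (suc zero) (ones k)))
        (bit-ones k a)

module Extremal (k : ℕ) where

  M : ℕ
  M = 2 ^ k

  link : Fin k ⊎ Fin M → Fin k ⊎ Fin M → Bool
  link (inj₁ _) (inj₁ _) = false
  link (inj₁ a) (inj₂ i) = bit k i a
  link (inj₂ i) (inj₁ a) = bit k i a
  link (inj₂ i) (inj₂ j) = not (does (i ≟ j))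

  link-sym : ∀ s t → link s t ≡ link t s
  link-sym (inj₁ _) (inj₁ _) = refl
  link-sym (inj₁ a) (inj₂ i) = refl
  link-sym (inj₂ i) (inj₁ a) = refl
  link-sym (inj₂ i) (inj₂ j) with i ≟ j | j ≟ i
  ... | yes _   | yes _   = refl
  ... | no  _   | no  _   = refl
  ... | yes i≡j | no  j≢i = contradiction (sym i≡j) j≢i
  ... | no  i≢j | yes j≡i = contradiction (sym j≡i) i≢j

  link-irrefl : ∀ s → link s s ≡ false
  link-irrefl (inj₁ _) = refl
  link-irrefl (inj₂ i) with i ≟ i
  ... | yes _   = refl
  ... | no  i≢i = contradiction refl i≢i

  graph : Graph
  graph = record
    { n      = k + M
    ; adj    = λ x y → link (splitAt k x) (splitAt k y)
    ; sym    = λ x y → link-sym (splitAt k x) (splitAt k y)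
    ; irrefl = λ x → link-irrefl (splitAt k x)
    }

  data Part : Fin (k + M) → Set where
    inA : (a : Fin k) → Part (a ↑ˡ M)
    inB : (i : Fin M) → Part (k ↑ʳ i)

  part : ∀ x → Part x
  part x with splitAt k x in split
  ... | inj₁ a = subst Part (splitAt⁻¹-↑ˡ split) (inA a)
  ... | inj₂ i = subst Part (splitAt⁻¹-↑ʳ split) (inB i)

  adj-BA : ∀ i a → adj graph (k ↑ʳ i) (a ↑ˡ M) ≡ bit k i a
  adj-BA i a rewrite splitAt-↑ʳ k M i | splitAt-↑ˡ k a M = refl

  adj-BB : ∀ i j → adj graph (k ↑ʳ i) (k ↑ʳ j) ≡ not (does (i ≟ j))
  adj-BB i j rewrite splitAt-↑ʳ k M i | splitAt-↑ʳ k M j = refl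

  A≢B : ∀ {a i} → a ↑ˡ M ≢ k ↑ʳ i
  A≢B {a} {i} eq with trans (sym (splitAt-↑ˡ k a M)) (trans (cong (splitAt k) eq) (splitAt-↑ʳ k M i))
  ... | ()

  A : Subset (k + M)
  A = ⊤ {k} ++ ⊥ {M}

  ∣A∣ : ∣ A ∣ ≡ k
  ∣A∣ = begin
    ∣ ⊤ {k} ++ ⊥ {M} ∣    ≡⟨ size-++ (⊤ {k}) (⊥ {M}) ⟩
    ∣ ⊤ {k} ∣ + ∣ ⊥ {M} ∣  ≡⟨ cong₂ _+_ (∣⊤∣≡n k) (∣⊥∣≡0 M) ⟩
    k + 0                 ≡⟨ +-identityʳ k ⟩
    k                     ∎
    where
    size-++ : ∀ {p q} (P : Subset p) (Q : Subset q) → ∣ P ++ Q ∣ ≡ ∣ P ∣ + ∣ Q ∣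
    size-++ []            Q = refl
    size-++ (inside  ∷ P) Q = cong suc (size-++ P Q)
    size-++ (outside ∷ P) Q = size-++ P Q
    open ≡-Reasoning

  ∈A : ∀ a → a ↑ˡ M ∈ A
  ∈A a = lookup⇒[]= (a ↑ˡ M) A (trans (lookup-++ˡ (⊤ {k}) (⊥ {M}) a) (lookup-replicate a inside))

  -- Vertices of A resolve themselves; two vertices of B with different
  -- codes are resolved by a vertex of A at a bit where the codes differ.
  A-resolving : IsAdjResolving graph A
  A-resolving x y x≢y with part x | part y
  ... | inA a | _     = x , ∈A a , self-resolves graph x≢y
  ... | inB i | inA b = y , ∈A b , λ eq → self-resolves graph (x≢y ∘ sym) (sym eq)
  ... | inB i | inB j with ¬∀⟶∃¬ k (λ a → bit k i a ≡ bit k j a) (λ a → bit k i a ≟ᵇ bit k j a)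
                                 (x≢y ∘ cong (k ↑ʳ_) ∘ bits-injective k)
  ... | a , differ = a ↑ˡ M , ∈A a ,
        adjacency-resolves graph (A≢B ∘ sym) (A≢B ∘ sym)
          (λ eq → differ (trans (sym (adj-BA i a)) (trans eq (adj-BA j a))))

  adim : AdimIs graph k
  adim = (A , A-resolving , ∣A∣) , resolving-set-size graph k refl

  hub : Fin (k + M)
  hub = k ↑ʳ ones k

  hub-universal : ∀ x → x ≢ hub → adj graph hub x ≡ true
  hub-universal x x≢hub with part x
  ... | inA a = trans (adj-BA (ones k) a) (bit-ones k a)
  ... | inB j = trans (adj-BB (ones k) j) distinct
    where
    distinct : not (does (ones k ≟ j)) ≡ true
    distinct with ones k ≟ j
    ... | yes ones≡j = contradiction (cong (k ↑ʳ_) (sym ones≡j)) x≢hub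
    ... | no  _      = refl

-- The bound and its extremal graph exist for every k.
corollary3p11 : (k : ℕ) → 1 ≤ k →
    ((G : Graph) → AdimIs G k → (v : Fin (n G)) → degree G v ≤ k + 2 ^ k ∸ 1)
    × Σ Graph (λ G → AdimIs G k × Σ (Fin (n G)) (λ v → degree G v ≡ k + 2 ^ k ∸ 1))
corollary3p11 k _ = maximum-degree , (graph , adim , hub , universal-degree graph hub hub-universal)
  where
  open Extremal k
  maximum-degree : (G : Graph) → AdimIs G k → (v : Fin (n G)) → degree G v ≤ k + 2 ^ k ∸ 1
  maximum-degree G ((S , resolving , ∣S∣≡k) , _) v = begin
    degree G v              ≤⟨ degree-bound G v ⟩
    n G ∸ 1                 ≤⟨ ∸-monoˡ-≤ 1 (order-bound G S resolving) ⟩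
    ∣ S ∣ + 2 ^ ∣ S ∣ ∸ 1    ≡⟨ cong (λ s → s + 2 ^ s ∸ 1) ∣S∣≡k ⟩
    k + 2 ^ k ∸ 1           ∎
    where open ≤-Reasoning
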